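{- Let $G$ be a graph and let $\alpha\in H_1(G,\mathbb{Z})$ be nonzero. Then $\mathcal{C}_G(\alpha,l)$ is empty for all $l<\Vert\alpha\Vert$, and if $\mathcal{C}_G(\alpha,\Vert\alpha\Vert)$ is nonempty, then $\alpha$ is connected and every circuit in $\mathcal{C}_G(\alpha,\Vert\alpha\Vert)$ is direction-consistent.
   Context: A graph is finite, may have loops and multiple edges, and has no isolated vertices. Each edge $e$ of $G$ gives two oriented edges $\mathbf{e}$ and $\mathbf{e}^{ -1}$; $\mathbf{E}(G)$ is the set of all oriented edges, $\mathbf{e}(0),\mathbf{e}(1)$ the initial and terminal vertices. An orientation $\mathfrak{o}$ chooses one of the two oriented edges for each edge; $\mathbf{E}_{\mathfrak{o}}(G)$ is the set of chosen ones. A walk of length $l$ is a sequence $\mathbf{a}_1\cdots\mathbf{a}_l$ of oriented edges with $\mathbf{a}_{i+1}(0)=\mathbf{a}_i(1)$; closed if $\mathbf{a}_l(1)=\mathbf{a}_1(0)$. A circuit is a closed walk with no backtrack ($\mathbf{a}_{i+1}\neq\mathbf{a}_i^{ -1}$) and no tail ($\mathbf{a}_1\neq\mathbf{a}_l^{ -1}$). $C_1(G,\mathbb{Z})$ is the free abelian group on $\mathbf{E}_{\mathfrak{o}}(G)$, equivalently generated by $\mathbf{E}(G)$ with $\mathbf{e}^{ -1}=-\mathbf{e}$. For $\alpha=\sum_{\mathbf{e}\in\mathbf{E}_{\mathfrak{o}}(G)}c_{\mathbf{e}}\mathbf{e}$ put $\deg_\alpha(\mathbf{e})=c_{\mathbf{e}}$,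 $\deg_\alpha(\mathbf{e}^{ -1})=-c_{\mathbf{e}}$, and $\deg_\alpha(v)=\sum_{\mathbf{e}\in\mathbf{E}(G),\mathbf{e}(0)=v}\deg_\alpha(\mathbf{e})$. $H_1(G,\mathbb{Z})=\{\alpha\in C_1(G,\mathbb{Z}):\deg_\alpha(v)=0\ \forall v\}$. The abelianization of a walk $P=\mathbf{a}_1\cdots\mathbf{a}_l$ is $P^{\mathrm{ab}}=\sum_i\mathbf{a}_i$. $\Vert\alpha\Vert=\sum_{\mathbf{e}\in\mathbf{E}_{\mathfrak{o}}(G)}|c_{\mathbf{e}}|$. $\mathcal{C}_G(\alpha,l)$ is the set of circuits $C$ of length $l$ with $C^{\mathrm{ab}}=\alpha$. A nonzero $\alpha$ can be uniquely written as $\sum c_{\mathbf{e}}\mathbf{e}$ with all $c_{\mathbf{e}}>0$ over a set of oriented edges with distinct underlying edges; the support $\mathrm{supp}(\alpha)$ is the subgraph formed by these underlying edges and their endpoints, and $\alpha$ is connected if $\mathrm{supp}(\alpha)$ is connected. A walk is direction-consistent if there is an orientation $\mathfrak{o}$ of $G$ with all its oriented edges in $\mathbf{E}_{\mathfrak{o}}(G)$. -}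

module Defs where

open import Data.Nat using (ℕ; zero; suc)
open import Data.Fin using (Fin; _≟_)
open import Data.Bool using (Bool; true; false; not; if_then_else_)
open import Data.Integer using (ℤ; +_; -_; _+_; ∣_∣)
import Data.Nat as ℕ
open import Data.List using (List; []; _∷_; length; map; foldr; allFin)
open import Data.Nat.ListAction using (sum)
open import Data.Product using (Σ; _×_; _,_; ∃; proj₁; proj₂)
open import Data.Sum using (_⊎_)
open import Data.Unit using (⊤)
open import Data.Empty using (⊥)
open import Relation.Nullary using (¬_; does)
open import Relation.Binary.PropositionalEquality using (_≡_)

-- Vertices Fin n, edges Fin m; each edge e has a reference direction
-- src e → tgt e, used only to name its two oriented versions.
record Graph : Set where
  field
    n m : ℕ
    src tgt : Fin m → Fin n
    noIsolated : ∀ (v : Fin n) → ∃ λ (e : Fin m) → (src e ≡ v) ⊎ (tgt e ≡ v)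
open Graph public

module _ (G : Graph) where

  Vertex : Set
  Vertex = Fin (n G)

  Edge : Set
  Edge = Fin (m G)

  -- oriented edge: (e , true) is e in the reference direction, (e , false) its inverse
  OEdge : Set
  OEdge = Edge × Bool

  start : OEdge → Vertex
  start (e , true)  = src G e
  start (e , false) = tgt G e

  end : OEdge → Vertex
  end (e , true)  = tgt G e
  end (e , false) = src G e

  inv : OEdge → OEdge
  inv (e , b) = (e , not b)

  -- orientations: a choice of one oriented edge per edge
  Orientation : Set
  Orientation = Edge → Bool

  InOrientation : Orientation → OEdge → Set
  InOrientation o (e , b) = b ≡ o e

  -- C₁(G,ℤ): coefficients with respect to the reference orientation
  C1 : Set
  C1 = Edge → ℤ

  zeroC1 : C1
  zeroC1 _ = + 0

  degE : C1 → OEdge → ℤ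
  degE α (e , true)  = α e
  degE α (e , false) = - α e

  allOEdges : List OEdge
  allOEdges = foldr (λ e r → (e , true) ∷ (e , false) ∷ r) [] (allFin (m G))

  sumℤ : List ℤ → ℤ
  sumℤ = foldr _+_ (+ 0)

  degV : C1 → Vertex → ℤ
  degV α v = sumℤ (map (λ a → if does (start a ≟ v) then degE α a else + 0) allOEdges)

  InH1 : C1 → Set
  InH1 α = ∀ v → degV α v ≡ + 0

  norm : C1 → ℕ
  norm α = sum (map (λ e → ∣ α e ∣) (allFin (m G)))

  Consecutive : List OEdge → Set
  Consecutive [] = ⊤
  Consecutive (a ∷ []) = ⊤
  Consecutive (a ∷ b ∷ w) = (start b ≡ end a) × Consecutive (b ∷ w)

  NoBacktrack : List OEdge → Set
  NoBacktrack [] = ⊤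
  NoBacktrack (a ∷ []) = ⊤
  NoBacktrack (a ∷ b ∷ w) = (¬ b ≡ inv a) × NoBacktrack (b ∷ w)

  lastOr : OEdge → List OEdge → OEdge
  lastOr a [] = a
  lastOr a (b ∷ w) = lastOr b w

  ClosedNoTail : List OEdge → Set
  ClosedNoTail [] = ⊤
  ClosedNoTail (a ∷ w) = (end (lastOr a w) ≡ start a) × (¬ a ≡ inv (lastOr a w))

  IsCircuit : List OEdge → Set
  IsCircuit w = Consecutive w × NoBacktrack w × ClosedNoTail w

  unitC1 : OEdge → C1
  unitC1 (e , b) e' = if does (e ≟ e') then degE (λ _ → + 1) (e , b) else + 0

  ab : List OEdge → C1
  ab [] = zeroC1
  ab (a ∷ w) e = unitC1 a e + ab w e

  InCircuitSet : C1 → ℕ → List OEdge → Set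
  InCircuitSet α l C = IsCircuit C × length C ≡ l × (∀ e → ab C e ≡ α e)

  InSupp : C1 → Edge → Set
  InSupp α e = ¬ α e ≡ + 0

  data SuppReach (α : C1) : Vertex → Vertex → Set where
    here : ∀ {v} → SuppReach α v v
    step : ∀ {u w} (a : OEdge) → InSupp α (proj₁ a) → start a ≡ u →
           SuppReach α (end a) w → SuppReach α u w

  -- supp(α) is connected: any two of its vertices are joined inside it
  -- (every vertex of supp(α) is an endpoint of a support edge)
  Connected : C1 → Set
  Connected α = ∀ (e e' : Edge) → InSupp α e → InSupp α e' →
                SuppReach α (src G e) (src G e')

  data AllOE (P : OEdge → Set) : List OEdge → Set where
    []  : AllOE P []
    _∷_ : ∀ {a w} → P a → AllOE P w → AllOE P (a ∷ w)

  DirectionConsistent : List OEdge → Set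
  DirectionConsistent w = Σ Orientation λ o → AllOE (InOrientation o) w

{-# OPTIONS --safe #-}
-- Every oriented edge changes the abelianization in a single coordinate by ±1, so by the
-- triangle inequality ‖Cᵃᵇ‖ ≤ length C.  If equality holds, it holds for every suffix of C, and
-- the first edge a of each suffix a ∷ w must then move the coordinate of wᵃᵇ away from 0, i.e.
-- wᵃᵇ is nonnegative along a.  By induction along C, Cᵃᵇ = α is positive along every oriented
-- edge of C.  Hence C follows the orientation given by the signs of α, the edges of C lie in
-- supp(α), and every edge of supp(α) occurs in C; so supp(α) is the trace of the walk C.
module Submission where

open import Defs
open import Data.Nat using (ℕ; _<_)
open import Data.Integer using (+_)
open import Data.List using (List)
open import Data.Product using (_×_; ∃)
open import Relation.Nullary using (¬_)
open import Relation.Binary.PropositionalEquality using (_≡_)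

open import Data.Bool using (true; false; if_then_else_)
open import Data.Empty using (⊥-elim)
open import Data.Fin using (Fin; zero; suc; _≟_; punchIn)
open import Data.Fin.Properties using (punchInᵢ≢i)
open import Data.Integer.Base as ℤ using (-[1+_]; 0ℤ; 1ℤ; ∣_∣; -_)
import Data.Integer.Properties as ℤ
open import Data.List using ([]; _∷_; length; map; tabulate; allFin)
open import Data.List.Properties using (map-tabulate)
open import Data.List.Membership.Propositional using (_∈_)
open import Data.List.Relation.Unary.Any using (here; there)
import Data.Nat as ℕ
open import Data.Nat using (zero; suc; z≤n; s≤s; _≤_)
import Data.Nat.Properties as ℕ
open import Data.Nat.ListAction using (sum)
open import Data.Product using (_,_; proj₁)
open import Data.Sum using (_⊎_; inj₁; inj₂)
open import Function using (_∘_; id)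
open import Relation.Nullary using (yes; no)
open import Relation.Nullary.Decidable using (does; dec-true; dec-false)
open import Relation.Binary.PropositionalEquality
  using (_≢_; _≗_; refl; sym; trans; cong; cong₂; subst; module ≡-Reasoning)
open import Algebra.Properties.CommutativeMonoid.Sum ℕ.+-0-commutativeMonoid
  using (sum-remove; sum-cong-≗; sum-replicate-zero; ∑-distrib-+)
  renaming (sum to ∑)

sum-map-allFin : ∀ {n} (f : Fin n → ℕ) → sum (map f (allFin n)) ≡ ∑ f
sum-map-allFin f = trans (cong sum (map-tabulate id f)) (sum-tabulate f)
  where
  sum-tabulate : ∀ {n} (g : Fin n → ℕ) → sum (tabulate g) ≡ ∑ g
  sum-tabulate {zero}  g = refl
  sum-tabulate {suc n} g = cong (g zero ℕ.+_) (sum-tabulate (g ∘ suc))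

∑-mono-≤ : ∀ {n} {f g : Fin n → ℕ} → (∀ i → f i ≤ g i) → ∑ f ≤ ∑ g
∑-mono-≤ {zero}  _   = z≤n
∑-mono-≤ {suc n} f≤g = ℕ.+-mono-≤ (f≤g zero) (∑-mono-≤ (f≤g ∘ suc))

f≤g∧∑g≤∑f⇒f≗g : ∀ {n} {f g : Fin n → ℕ} → (∀ i → f i ≤ g i) → ∑ g ≤ ∑ f → f ≗ g
f≤g∧∑g≤∑f⇒f≗g {suc n} {f} {g} f≤g ∑g≤∑f zero =
  ℕ.≤-antisym (f≤g zero) (ℕ.+-cancelʳ-≤ (∑ (f ∘ suc)) (g zero) (f zero) (begin
    g zero ℕ.+ ∑ (f ∘ suc) ≤⟨ ℕ.+-monoʳ-≤ (g zero) (∑-mono-≤ (f≤g ∘ suc)) ⟩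
    g zero ℕ.+ ∑ (g ∘ suc) ≤⟨ ∑g≤∑f ⟩
    f zero ℕ.+ ∑ (f ∘ suc) ∎))
  where open ℕ.≤-Reasoning
f≤g∧∑g≤∑f⇒f≗g {suc n} {f} {g} f≤g ∑g≤∑f (suc i) =
  f≤g∧∑g≤∑f⇒f≗g (f≤g ∘ suc) (ℕ.+-cancelˡ-≤ (g zero) (∑ (g ∘ suc)) (∑ (f ∘ suc)) (begin
    g zero ℕ.+ ∑ (g ∘ suc) ≤⟨ ∑g≤∑f ⟩
    f zero ℕ.+ ∑ (f ∘ suc) ≤⟨ ℕ.+-monoˡ-≤ (∑ (f ∘ suc)) (f≤g zero) ⟩
    g zero ℕ.+ ∑ (f ∘ suc) ∎)) i
  where open ℕ.≤-Reasoning

∑-supported-at : ∀ {n} (f : Fin n → ℕ) i → (∀ j → j ≢ i → f j ≡ 0) → ∑ f ≡ f i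
∑-supported-at {suc n} f i f≡0 = begin
  ∑ f                                ≡⟨ sum-remove {i = i} f ⟩
  f i ℕ.+ ∑ (f ∘ punchIn i)          ≡⟨ cong (f i ℕ.+_) (sum-cong-≗ (λ j → f≡0 _ (punchInᵢ≢i i j))) ⟩
  f i ℕ.+ ∑ {n} (λ _ → 0)            ≡⟨ cong (f i ℕ.+_) (sum-replicate-zero n) ⟩
  f i ℕ.+ 0                          ≡⟨ ℕ.+-identityʳ (f i) ⟩
  f i                                ∎
  where open ≡-Reasoning

∣1+i∣≡1+∣i∣⇒0≤i : ∀ i → ∣ 1ℤ ℤ.+ i ∣ ≡ suc ∣ i ∣ → 0ℤ ℤ.≤ i
∣1+i∣≡1+∣i∣⇒0≤i (+ _)           _  = ℤ.+≤+ z≤n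
∣1+i∣≡1+∣i∣⇒0≤i -[1+ zero ]     ()
∣1+i∣≡1+∣i∣⇒0≤i -[1+ suc k ] eq = ⊥-elim (ℕ.m≢1+n+m k (ℕ.suc-injective eq))

0≤i⇒0<1+i : ∀ {i} → 0ℤ ℤ.≤ i → 0ℤ ℤ.< 1ℤ ℤ.+ i
0≤i⇒0<1+i (ℤ.+≤+ _) = ℤ.+<+ (s≤s z≤n)

module _ (G : Graph) where

  _⊕_ : C1 G → C1 G → C1 G
  (α ⊕ β) e = α e ℤ.+ β e

  norm≡∑ : (α : C1 G) → norm G α ≡ ∑ (∣_∣ ∘ α)
  norm≡∑ α = sum-map-allFin (∣_∣ ∘ α)

  norm-cong : ∀ {α β : C1 G} → α ≗ β → norm G α ≡ norm G β
  norm-cong {α} {β} α≗β = begin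
    norm G α         ≡⟨ norm≡∑ α ⟩
    ∑ (∣_∣ ∘ α)      ≡⟨ sum-cong-≗ (cong ∣_∣ ∘ α≗β) ⟩
    ∑ (∣_∣ ∘ β)      ≡⟨ norm≡∑ β ⟨
    norm G β         ∎
    where open ≡-Reasoning

  ∑∣∣-distrib : (α β : C1 G) → ∑ (λ e → ∣ α e ∣ ℕ.+ ∣ β e ∣) ≡ norm G α ℕ.+ norm G β
  ∑∣∣-distrib α β = begin
    ∑ (λ e → ∣ α e ∣ ℕ.+ ∣ β e ∣)  ≡⟨ ∑-distrib-+ (∣_∣ ∘ α) (∣_∣ ∘ β) ⟩
    ∑ (∣_∣ ∘ α) ℕ.+ ∑ (∣_∣ ∘ β)    ≡⟨ cong₂ ℕ._+_ (norm≡∑ α) (norm≡∑ β) ⟨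
    norm G α ℕ.+ norm G β          ∎
    where open ≡-Reasoning

  norm-⊕-≤ : (α β : C1 G) → norm G (α ⊕ β) ≤ norm G α ℕ.+ norm G β
  norm-⊕-≤ α β = begin
    norm G (α ⊕ β)                 ≡⟨ norm≡∑ (α ⊕ β) ⟩
    ∑ (∣_∣ ∘ (α ⊕ β))              ≤⟨ ∑-mono-≤ (λ e → ℤ.∣i+j∣≤∣i∣+∣j∣ (α e) (β e)) ⟩
    ∑ (λ e → ∣ α e ∣ ℕ.+ ∣ β e ∣)  ≡⟨ ∑∣∣-distrib α β ⟩
    norm G α ℕ.+ norm G β          ∎
    where open ℕ.≤-Reasoning

  norm-⊕-additive⇒∣+∣-additive : (α β : C1 G) → norm G α ℕ.+ norm G β ≤ norm G (α ⊕ β) →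
                                  ∀ e → ∣ α e ℤ.+ β e ∣ ≡ ∣ α e ∣ ℕ.+ ∣ β e ∣
  norm-⊕-additive⇒∣+∣-additive α β additive =
    f≤g∧∑g≤∑f⇒f≗g (λ e → ℤ.∣i+j∣≤∣i∣+∣j∣ (α e) (β e)) (begin
      ∑ (λ e → ∣ α e ∣ ℕ.+ ∣ β e ∣)  ≡⟨ ∑∣∣-distrib α β ⟩
      norm G α ℕ.+ norm G β          ≤⟨ additive ⟩
      norm G (α ⊕ β)                 ≡⟨ norm≡∑ (α ⊕ β) ⟩
      ∑ (∣_∣ ∘ (α ⊕ β))              ∎)
    where open ℕ.≤-Reasoning

  degE-cong : ∀ {α β : C1 G} → α ≗ β → ∀ c → degE G α c ≡ degE G β c
  degE-cong α≗β (e , true)  = α≗β e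
  degE-cong α≗β (e , false) = cong -_ (α≗β e)

  degE-⊕ : (α β : C1 G) → ∀ c → degE G (α ⊕ β) c ≡ degE G α c ℤ.+ degE G β c
  degE-⊕ α β (e , true)  = refl
  degE-⊕ α β (e , false) = ℤ.neg-distrib-+ (α e) (β e)

  degE-inv : (α : C1 G) → ∀ c → degE G α (inv G c) ≡ - degE G α c
  degE-inv α (e , true)  = refl
  degE-inv α (e , false) = sym (ℤ.neg-involutive (α e))

  ∣degE∣ : (α : C1 G) → ∀ c → ∣ degE G α c ∣ ≡ ∣ α (proj₁ c) ∣
  ∣degE∣ α (e , true)  = refl
  ∣degE∣ α (e , false) = ℤ.∣-i∣≡∣i∣ (α e)

  same-edge⇒≡⊎≡inv : ∀ (a c : OEdge G) → proj₁ a ≡ proj₁ c → a ≡ c ⊎ a ≡ inv G c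
  same-edge⇒≡⊎≡inv (e , true)  (.e , true)  refl = inj₁ refl
  same-edge⇒≡⊎≡inv (e , true)  (.e , false) refl = inj₂ refl
  same-edge⇒≡⊎≡inv (e , false) (.e , true)  refl = inj₂ refl
  same-edge⇒≡⊎≡inv (e , false) (.e , false) refl = inj₁ refl

  unitC1-other : ∀ a {e} → proj₁ a ≢ e → unitC1 G a e ≡ 0ℤ
  unitC1-other (e₀ , b) {e} e₀≢e = cong (λ d → if d then _ else 0ℤ) (dec-false (e₀ ≟ e) e₀≢e)

  degE-unitC1-other : ∀ a c → proj₁ a ≢ proj₁ c → degE G (unitC1 G a) c ≡ 0ℤ
  degE-unitC1-other a (e , true)  a≢c = unitC1-other a a≢c
  degE-unitC1-other a (e , false) a≢c = cong -_ (unitC1-other a a≢c)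

  unitC1-self : ∀ e b → unitC1 G (e , b) e ≡ degE G (λ _ → 1ℤ) (e , b)
  unitC1-self e b = cong (λ d → if d then degE G (λ _ → 1ℤ) (e , b) else 0ℤ) (dec-true (e ≟ e) refl)

  degE-unitC1-self : ∀ a → degE G (unitC1 G a) a ≡ 1ℤ
  degE-unitC1-self (e , true)  = unitC1-self e true
  degE-unitC1-self (e , false) = cong -_ (unitC1-self e false)

  norm-unitC1 : ∀ a → norm G (unitC1 G a) ≡ 1
  norm-unitC1 a = begin
    norm G (unitC1 G a)             ≡⟨ norm≡∑ (unitC1 G a) ⟩
    ∑ (∣_∣ ∘ unitC1 G a)            ≡⟨ ∑-supported-at _ (proj₁ a) off-a ⟩
    ∣ unitC1 G a (proj₁ a) ∣        ≡⟨ ∣degE∣ (unitC1 G a) a ⟨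
    ∣ degE G (unitC1 G a) a ∣       ≡⟨ cong ∣_∣ (degE-unitC1-self a) ⟩
    1                               ∎
    where
    open ≡-Reasoning
    off-a : ∀ e → e ≢ proj₁ a → ∣ unitC1 G a e ∣ ≡ 0
    off-a e e≢a = cong ∣_∣ (unitC1-other a (e≢a ∘ sym))

  -- ab (a ∷ w) is definitionally unitC1 a ⊕ ab w.
  norm-ab-∷-≤ : ∀ a w → norm G (ab G (a ∷ w)) ≤ suc (norm G (ab G w))
  norm-ab-∷-≤ a w = ℕ.≤-trans (norm-⊕-≤ (unitC1 G a) (ab G w))
                              (ℕ.≤-reflexive (cong (ℕ._+ norm G (ab G w)) (norm-unitC1 a)))

  norm-ab≤length : ∀ w → norm G (ab G w) ≤ length w
  norm-ab≤length []      = ℕ.≤-reflexive (trans (norm≡∑ (ab G [])) (sum-replicate-zero (m G)))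
  norm-ab≤length (a ∷ w) = ℕ.≤-trans (norm-ab-∷-≤ a w) (s≤s (norm-ab≤length w))

  Tight : List (OEdge G) → Set
  Tight w = norm G (ab G w) ≡ length w

  Tight-∷⇒Tight : ∀ a w → Tight (a ∷ w) → Tight w
  Tight-∷⇒Tight a w tight = ℕ.≤-antisym (norm-ab≤length w) (ℕ.s≤s⁻¹ (begin
    suc (length w)          ≡⟨ tight ⟨
    norm G (ab G (a ∷ w))   ≤⟨ norm-ab-∷-≤ a w ⟩
    suc (norm G (ab G w))   ∎))
    where open ℕ.≤-Reasoning

  Tight-∷⇒0≤degE : ∀ a w → Tight (a ∷ w) → 0ℤ ℤ.≤ degE G (ab G w) a
  Tight-∷⇒0≤degE a w tight = ∣1+i∣≡1+∣i∣⇒0≤i x (begin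
    ∣ 1ℤ ℤ.+ x ∣                          ≡⟨ cong (λ y → ∣ y ℤ.+ x ∣) (degE-unitC1-self a) ⟨
    ∣ degE G (unitC1 G a) a ℤ.+ x ∣       ≡⟨ cong ∣_∣ (degE-⊕ (unitC1 G a) (ab G w) a) ⟨
    ∣ degE G (ab G (a ∷ w)) a ∣           ≡⟨ ∣degE∣ (ab G (a ∷ w)) a ⟩
    ∣ ab G (a ∷ w) e ∣                    ≡⟨ norm-⊕-additive⇒∣+∣-additive (unitC1 G a) (ab G w) additive e ⟩
    ∣ unitC1 G a e ∣ ℕ.+ ∣ ab G w e ∣     ≡⟨ cong₂ ℕ._+_ (∣degE∣ (unitC1 G a) a) (∣degE∣ (ab G w) a) ⟨
    ∣ degE G (unitC1 G a) a ∣ ℕ.+ ∣ x ∣   ≡⟨ cong (λ y → ∣ y ∣ ℕ.+ ∣ x ∣) (degE-unitC1-self a) ⟩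
    suc ∣ x ∣                             ∎)
    where
    open ≡-Reasoning
    e = proj₁ a
    x = degE G (ab G w) a
    additive : norm G (unitC1 G a) ℕ.+ norm G (ab G w) ≤ norm G (ab G (a ∷ w))
    additive = ℕ.≤-reflexive (begin
      norm G (unitC1 G a) ℕ.+ norm G (ab G w)   ≡⟨ cong₂ ℕ._+_ (norm-unitC1 a) (Tight-∷⇒Tight a w tight) ⟩
      suc (length w)                            ≡⟨ tight ⟨
      norm G (ab G (a ∷ w))                     ∎)

  0<degE-unitC1⊕-self : ∀ a (β : C1 G) → 0ℤ ℤ.≤ degE G β a → 0ℤ ℤ.< degE G (unitC1 G a ⊕ β) a
  0<degE-unitC1⊕-self a β 0≤βa = subst (0ℤ ℤ.<_) (begin
    1ℤ ℤ.+ degE G β a                    ≡⟨ cong (ℤ._+ degE G β a) (degE-unitC1-self a) ⟨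
    degE G (unitC1 G a) a ℤ.+ degE G β a ≡⟨ degE-⊕ (unitC1 G a) β a ⟨
    degE G (unitC1 G a ⊕ β) a            ∎)
    (0≤i⇒0<1+i 0≤βa)
    where open ≡-Reasoning

  0<degE-unitC1⊕ : ∀ a c (β : C1 G) → 0ℤ ℤ.≤ degE G β a → 0ℤ ℤ.< degE G β c →
                   0ℤ ℤ.< degE G (unitC1 G a ⊕ β) c
  0<degE-unitC1⊕ a c β 0≤βa 0<βc with proj₁ a ≟ proj₁ c
  ... | no a≁c = subst (0ℤ ℤ.<_) (begin
    degE G β c                           ≡⟨ ℤ.+-identityˡ (degE G β c) ⟨
    0ℤ ℤ.+ degE G β c                    ≡⟨ cong (ℤ._+ degE G β c) (degE-unitC1-other a c a≁c) ⟨
    degE G (unitC1 G a) c ℤ.+ degE G β c ≡⟨ degE-⊕ (unitC1 G a) β c ⟨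
    degE G (unitC1 G a ⊕ β) c            ∎)
    0<βc
    where open ≡-Reasoning
  ... | yes a∼c with same-edge⇒≡⊎≡inv a c a∼c
  ...   | inj₁ refl = 0<degE-unitC1⊕-self a β 0≤βa
  ...   | inj₂ refl = ⊥-elim (ℤ.≤⇒≯ (subst (0ℤ ℤ.≤_) (degE-inv β c) 0≤βa) (ℤ.neg-mono-< 0<βc))

  Tight⇒0<degE : ∀ w → Tight w → ∀ {c} → c ∈ w → 0ℤ ℤ.< degE G (ab G w) c
  Tight⇒0<degE (a ∷ w) tight (here refl) =
    0<degE-unitC1⊕-self a (ab G w) (Tight-∷⇒0≤degE a w tight)
  Tight⇒0<degE (a ∷ w) tight {c} (there c∈w) =
    0<degE-unitC1⊕ a c (ab G w) (Tight-∷⇒0≤degE a w tight)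
      (Tight⇒0<degE w (Tight-∷⇒Tight a w tight) c∈w)

  0<degE⇒InSupp : ∀ (α : C1 G) c → 0ℤ ℤ.< degE G α c → InSupp G α (proj₁ c)
  0<degE⇒InSupp α (e , true)  0<αc αe≡0 = ℤ.<-irrefl refl (subst (0ℤ ℤ.<_) αe≡0 0<αc)
  0<degE⇒InSupp α (e , false) 0<αc αe≡0 = ℤ.<-irrefl refl (subst (λ x → 0ℤ ℤ.< - x) αe≡0 0<αc)

  signOrientation : C1 G → Orientation G
  signOrientation α e = does (0ℤ ℤ.≤? α e)

  0<degE⇒InOrientation : ∀ (α : C1 G) c → 0ℤ ℤ.< degE G α c → InOrientation G (signOrientation α) c
  0<degE⇒InOrientation α (e , true)  0<αe  = sym (dec-true (0ℤ ℤ.≤? α e) (ℤ.<⇒≤ 0<αe))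
  0<degE⇒InOrientation α (e , false) 0<-αe =
    sym (dec-false (0ℤ ℤ.≤? α e) (ℤ.<⇒≱ 0<-αe ∘ ℤ.neg-mono-≤))

  AllOE-tabulate : ∀ {P : OEdge G → Set} w → (∀ {c} → c ∈ w → P c) → AllOE G P w
  AllOE-tabulate []      _  = []
  AllOE-tabulate (a ∷ w) Pw = Pw (here refl) ∷ AllOE-tabulate w (Pw ∘ there)

  ab-support : ∀ w {e} → ab G w e ≢ 0ℤ → ∃ λ c → c ∈ w × proj₁ c ≡ e
  ab-support []      w≢0 = ⊥-elim (w≢0 refl)
  -- Matching on proj₁ a ≟ e reduces unitC1 a e to 0ℤ in the type of a∷w≢0.
  ab-support (a ∷ w) {e} a∷w≢0 with proj₁ a ≟ e
  ... | yes a∼e = a , here refl , a∼e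
  ... | no a≁e with ab-support w (a∷w≢0 ∘ trans (ℤ.+-identityˡ (ab G w e)))
  ...   | c , c∈w , c∼e = c , there c∈w , c∼e

  module _ {α : C1 G} where

    SuppReach-trans : ∀ {u v x} → SuppReach G α u v → SuppReach G α v x → SuppReach G α u x
    SuppReach-trans here             v↝x = v↝x
    SuppReach-trans (step a s eq a↝v) v↝x = step a s eq (SuppReach-trans a↝v v↝x)

    SuppReach-edge : ∀ a → InSupp G α (proj₁ a) → SuppReach G α (start G a) (end G a)
    SuppReach-edge a s = step a s refl here

    SuppReach-edge⁻¹ : ∀ a → InSupp G α (proj₁ a) → SuppReach G α (end G a) (start G a)
    SuppReach-edge⁻¹ (e , true)  = SuppReach-edge (e , false)
    SuppReach-edge⁻¹ (e , false) = SuppReach-edge (e , true)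

    SuppReach-sym : ∀ {u v} → SuppReach G α u v → SuppReach G α v u
    SuppReach-sym here               = here
    SuppReach-sym (step a s refl a↝v) = SuppReach-trans (SuppReach-sym a↝v) (SuppReach-edge⁻¹ a s)

    SuppReach-end-src : ∀ c → InSupp G α (proj₁ c) → SuppReach G α (end G c) (src G (proj₁ c))
    SuppReach-end-src (e , true)  = SuppReach-edge⁻¹ (e , true)
    SuppReach-end-src (e , false) _ = here

    walk-SuppReach : ∀ a w → Consecutive G (a ∷ w) → (∀ {c} → c ∈ a ∷ w → InSupp G α (proj₁ c)) →
                     ∀ {c} → c ∈ a ∷ w → SuppReach G α (start G a) (end G c)
    walk-SuppReach a w       _              inSupp (here refl) = SuppReach-edge a (inSupp (here refl))
    walk-SuppReach a (b ∷ w) (b-follows-a , b∷w-ok) inSupp (there c∈b∷w) =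
      step a (inSupp (here refl)) refl
        (subst (λ v → SuppReach G α v _) b-follows-a (walk-SuppReach b w b∷w-ok (inSupp ∘ there) c∈b∷w))

    walk-Connected : ∀ w → Consecutive G w → (∀ {c} → c ∈ w → InSupp G α (proj₁ c)) →
                     (∀ {e} → InSupp G α e → ∃ λ c → c ∈ w × proj₁ c ≡ e) → Connected G α
    walk-Connected [] _ _ covers e _ e∈supp _ with covers e∈supp
    ... | _ , () , _
    walk-Connected (a ∷ w) ok inSupp covers e e′ e∈supp e′∈supp =
      SuppReach-trans (SuppReach-sym (reach e∈supp)) (reach e′∈supp)
      where
      reach : ∀ {e} → InSupp G α e → SuppReach G α (start G a) (src G e)
      reach e∈supp with covers e∈supp
      ... | c , c∈a∷w , refl =
        SuppReach-trans (walk-SuppReach a w ok inSupp c∈a∷w) (SuppReach-end-src c (inSupp c∈a∷w))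

lemma3p1 : (G : Graph) (α : C1 G) → InH1 G α → ¬ (∀ e → α e ≡ + 0) →
  ((l : ℕ) → l < norm G α → (C : List (OEdge G)) → ¬ InCircuitSet G α l C)
  × ((∃ λ (C : List (OEdge G)) → InCircuitSet G α (norm G α) C) →
      Connected G α
      × ((C : List (OEdge G)) → InCircuitSet G α (norm G α) C → DirectionConsistent G C))
lemma3p1 G α _ _ = no-shorter-circuit , minimal-circuit
  where
  no-shorter-circuit : (l : ℕ) → l < norm G α → (C : List (OEdge G)) → ¬ InCircuitSet G α l C
  no-shorter-circuit _ l<‖α‖ C (_ , refl , C≗α) =
    ℕ.<⇒≱ l<‖α‖ (ℕ.≤-trans (ℕ.≤-reflexive (norm-cong G (sym ∘ C≗α))) (norm-ab≤length G C))

  positive-along : ∀ {C} → InCircuitSet G α (norm G α) C → ∀ {c} → c ∈ C → 0ℤ ℤ.< degE G α c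
  positive-along {C} (_ , len≡‖α‖ , C≗α) {c} c∈C =
    subst (0ℤ ℤ.<_) (degE-cong G C≗α c)
      (Tight⇒0<degE G C (trans (norm-cong G C≗α) (sym len≡‖α‖)) c∈C)

  minimal-circuit : (∃ λ (C : List (OEdge G)) → InCircuitSet G α (norm G α) C) →
    Connected G α × ((C : List (OEdge G)) → InCircuitSet G α (norm G α) C → DirectionConsistent G C)
  minimal-circuit (C₀ , C₀-min@((C₀-walk , _) , _ , C₀≗α)) =
    walk-Connected G C₀ C₀-walk (λ {c} → 0<degE⇒InSupp G α c ∘ positive-along C₀-min)
      (λ {e} e∈supp → ab-support G C₀ (e∈supp ∘ trans (sym (C₀≗α e)))) ,
    λ C C-min → signOrientation G α ,
      AllOE-tabulate G C (λ {c} → 0<degE⇒InOrientation G α c ∘ positive-along C-min)
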